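{- Let $k<n$ and let $s$ be the schematic sequent $X\alpha_{n-k}\supset\bigwedge_{s\in S_{n-k}}Xs, F_n,\ldots,F_{n-k+1},Pa,(Ps\supset Pfs)_{s\in T_{n-k-1}}\rightarrow Pf^{2^{n+1}}a$. Then the substitution $[X\mapsto\lambda x.(\neg Px\lor Pf^{2^{n-k}}x)]$ is a solution of $s$.
   Context: Fix $n>0$, a unary predicate $P$, a unary function symbol $f$, a constant $a$, and variables $\alpha_1,\ldots,\alpha_n$, with $\alpha_{n+1}=a$. For $k=0,\ldots,n$ let $T_k=\{\alpha_{k+1},f\alpha_{k+1},\ldots,f^{2^{k+1}-1}\alpha_{k+1}\}$ and $S_k=\{\alpha_{k+1},f^{2^k}\alpha_{k+1}\}$. For $k=1,\ldots,n$ let $F_k=(\neg P\alpha_k\lor Pf^{2^k}\alpha_k)\supset\bigwedge_{s\in S_k}(\neg Ps\lor Pf^{2^k}s)$. A substitution $[X\mapsto\lambda x.A]$ is a solution of the schematic sequent $s$ if the sequent obtained from $s$ by replacing each $X(t)$ with $A$ with $x$ replaced by $t$ is valid (propositionally). -}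

module Defs where

open import Data.Nat using (ℕ; zero; suc; _+_; _∸_; _^_; _<_; _<?_)
open import Data.Fin using (Fin; fromℕ<)
open import Data.Bool using (Bool; true; false; not; _∧_; _∨_)
open import Data.List using (List; []; _∷_; map; upTo; foldr)
open import Data.List.Relation.Unary.All using (All)
open import Relation.Nullary using (yes; no)
open import Relation.Binary.PropositionalEquality using (_≡_)

data Term (n : ℕ) : Set where
  var : Fin n → Term n        -- var i  is  α_{i+1}
  a   : Term n
  f   : Term n → Term n

f^ : ∀ {n} → ℕ → Term n → Term n
f^ zero    t = t
f^ (suc m) t = f (f^ m t)

-- α_i for 1 ≤ i ≤ n, and α_{n+1} = a.  (α 0 and α i for i > n+1 are junk
-- values = a; they are never used in the statement.)
α : ∀ {n} → ℕ → Term n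
α zero = a
α {n} (suc i) with i <? n
... | yes p = var (fromℕ< p)
... | no  _ = a

data SForm (n : ℕ) : Set where
  P   : Term n → SForm n
  X   : Term n → SForm n
  ⊤'  : SForm n
  ¬'_ : SForm n → SForm n
  _∨'_ _∧'_ _⊃'_ : SForm n → SForm n → SForm n

data Form (n : ℕ) : Set where
  P   : Term n → Form n
  ⊤'  : Form n
  ¬'_ : Form n → Form n
  _∨'_ _∧'_ _⊃'_ : Form n → Form n → Form n

⋀ : ∀ {n} → List (SForm n) → SForm n
⋀ = foldr _∧'_ ⊤'

record SSequent (n : ℕ) : Set where
  constructor _⟶_
  field
    ante : List (SForm n)
    succ : SForm n

record Sequent (n : ℕ) : Set where
  constructor _⟶_
  field
    ante : List (Form n)
    succ : Form n

-- Propositional semantics: a valuation assigns a truth value to each atom P t.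
Valuation : ℕ → Set
Valuation n = Term n → Bool

⟦_⟧ : ∀ {n} → Form n → Valuation n → Bool
⟦ P t ⟧ v = v t
⟦ ⊤' ⟧ v = true
⟦ ¬' A ⟧ v = not (⟦ A ⟧ v)
⟦ A ∨' B ⟧ v = ⟦ A ⟧ v ∨ ⟦ B ⟧ v
⟦ A ∧' B ⟧ v = ⟦ A ⟧ v ∧ ⟦ B ⟧ v
⟦ A ⊃' B ⟧ v = not (⟦ A ⟧ v) ∨ ⟦ B ⟧ v

Valid : ∀ {n} → Sequent n → Set
Valid (Γ ⟶ C) = ∀ v → All (λ A → ⟦ A ⟧ v ≡ true) Γ → ⟦ C ⟧ v ≡ true

-- Substitution [X ↦ λx.A]: the body A is given as a function of the
-- term substituted for x, i.e. X(t) is replaced by A[x := t].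
substF : ∀ {n} → (Term n → Form n) → SForm n → Form n
substF A (P t) = P t
substF A (X t) = A t
substF A ⊤' = ⊤'
substF A (¬' B) = ¬' substF A B
substF A (B ∨' C) = substF A B ∨' substF A C
substF A (B ∧' C) = substF A B ∧' substF A C
substF A (B ⊃' C) = substF A B ⊃' substF A C

substS : ∀ {n} → (Term n → Form n) → SSequent n → Sequent n
substS A (Γ ⟶ C) = map (substF A) Γ ⟶ substF A C

IsSolution : ∀ {n} → SSequent n → (Term n → Form n) → Set
IsSolution s A = Valid (substS A s)

T : ∀ {n} → ℕ → List (Term n)
T k = map (λ j → f^ j (α (suc k))) (upTo (2 ^ suc k))

S : ∀ {n} → ℕ → List (Term n)
S k = α (suc k) ∷ f^ (2 ^ k) (α (suc k)) ∷ []

F : ∀ {n} → ℕ → SForm n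
F k = ((¬' P (α k)) ∨' P (f^ (2 ^ k) (α k)))
      ⊃' ⋀ (map (λ s → (¬' P s) ∨' P (f^ (2 ^ k) s)) (S k))

Fs : ∀ {n} → ℕ → List (SForm n)
Fs {n} k = map (λ j → F (n ∸ j)) (upTo k)

infixr 5 _++'_
_++'_ : ∀ {A : Set} → List A → List A → List A
[] ++' ys = ys
(x ∷ xs) ++' ys = x ∷ (xs ++' ys)

seqS : (n k : ℕ) → SSequent n
seqS n k =
  ((X (α (n ∸ k)) ⊃' ⋀ (map X (S (n ∸ k))))
    ∷ (Fs k ++' (P a ∷ map (λ s → P s ⊃' P (f s)) (T (n ∸ k ∸ 1)))))
  ⟶ P (f^ (2 ^ suc n) a)

solution : (n k : ℕ) → Term n → Form n
solution n k x = (¬' P x) ∨' P (f^ (2 ^ (n ∸ k)) x)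

module Submission where

-- Fix a valuation v and write  Reach v d t  for the
-- implication  P t → P (f^d t)  under v.  The substituted formula X t is
-- exactly  Reach v (2^(n-k)) t,  and the antecedent of F_i is
-- Reach v (2^i) α_i.  Put  m = n - k ≥ 1  and  Q i = Reach v (2^i) α_i.
--
--   * The chain (Ps ⊃ Pfs) over T_{m-1} composes 2^m single f-steps
--     starting at α_m, giving Q m.
--   * Each of  F_i  (m < i ≤ n)  and the substituted first antecedent
--     (which is literally F_m with X replaced) turns Q i into two
--     consecutive 2^i-steps at α_{i+1}, i.e. Q (i+1) by doubling.
--   * Climbing this ladder from m to n gives Q (n+1) = Reach v (2^(n+1)) a,
--     and together with the antecedent P a this is the succedent.

open import Defs
open import Data.Nat using (ℕ; zero; suc; _+_; _∸_; _^_; _<_; _≤_; _<?_; s≤s)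
open import Data.Nat.Properties
  using (<-irrefl; <-trans; n<1+n; <⇒≤; +-identityʳ; m<n⇒0<n∸m)
open import Data.Bool using (true; false; not; _∧_; _∨_)
open import Data.List using ([]; _∷_; map)
open import Data.List.Relation.Unary.All as All using (All; []; _∷_)
open import Data.List.Relation.Unary.All.Properties using (map⁻)
open import Data.List.Membership.Propositional.Properties using (∈-upTo⁺)
open import Data.Product using (_×_; _,_)
open import Data.Empty using (⊥-elim)
open import Relation.Nullary using (yes; no)
open import Relation.Binary.PropositionalEquality
  using (_≡_; refl; sym; cong; subst)

_⊨_ : ∀ {n} → Valuation n → Form n → Set
v ⊨ B = ⟦ B ⟧ v ≡ true

⊃-elim : ∀ {x y} → not x ∨ y ≡ true → x ≡ true → y ≡ true
⊃-elim {true} x⊃y refl = x⊃y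

⊃-intro : ∀ {x y} → (x ≡ true → y ≡ true) → not x ∨ y ≡ true
⊃-intro {false} _   = refl
⊃-intro {true}  x→y = x→y refl

∧-elimˡ : ∀ {x y} → x ∧ y ≡ true → x ≡ true
∧-elimˡ {true} _ = refl

∧-elimʳ : ∀ x {y} → x ∧ y ≡ true → y ≡ true
∧-elimʳ true x∧y = x∧y

suc[m∸1+n]≡m∸n : ∀ {m n} → n < m → suc (m ∸ suc n) ≡ m ∸ n
suc[m∸1+n]≡m∸n {suc m} {zero}  _         = refl
suc[m∸1+n]≡m∸n {suc m} {suc n} (s≤s n<m) = suc[m∸1+n]≡m∸n n<m

f^-+ : ∀ {n} p b (t : Term n) → f^ p (f^ b t) ≡ f^ (p + b) t
f^-+ zero    b t = refl
f^-+ (suc p) b t = cong f (f^-+ p b t)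

α-last : ∀ {n} → α {n} (suc n) ≡ a
α-last {n} with n <? n
... | yes n<n = ⊥-elim (<-irrefl refl n<n)
... | no  _   = refl

-- Reach v d t: under v, truth of P propagates d f-steps from t.
-- (A record rather than a bare function type, so that v, d and t can be
-- inferred from it.)
record Reach {n} (v : Valuation n) (d : ℕ) (t : Term n) : Set where
  constructor reach
  field run : v t ≡ true → v (f^ d t) ≡ true
open Reach

reach-elim : ∀ {n} {v : Valuation n} {d t} → not (v t) ∨ v (f^ d t) ≡ true → Reach v d t
reach-elim t⊃ = reach (⊃-elim t⊃)

reach-intro : ∀ {n} {v : Valuation n} {d t} → Reach v d t → not (v t) ∨ v (f^ d t) ≡ true
reach-intro r = ⊃-intro (run r)

reach-∘ : ∀ {n} {v : Valuation n} {d e t}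
        → Reach v e (f^ d t) → Reach v d t → Reach v (e + d) t
reach-∘ {v = v} {d} {e} {t} later first =
  reach (λ Pt → subst (λ u → v u ≡ true) (f^-+ e d t) (run later (run first Pt)))

reach-double : ∀ {n} {v : Valuation n} i {t}
             → Reach v (2 ^ i) (f^ (2 ^ i) t) → Reach v (2 ^ i) t → Reach v (2 ^ suc i) t
reach-double {v = v} i {t} later first =
  subst (λ d → Reach v d t) (cong (2 ^ i +_) (sym (+-identityʳ (2 ^ i))))
        (reach-∘ later first)

reach-chain : ∀ {n} {v : Valuation n} {t} N
            → (∀ j → j < N → Reach v 1 (f^ j t)) → Reach v N t
reach-chain zero    steps = reach (λ Pt → Pt)
reach-chain (suc N) steps =
  reach-∘ (steps N (n<1+n N)) (reach-chain N (λ j j<N → steps j (<-trans j<N (n<1+n N))))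

Q : ∀ {n} → Valuation n → ℕ → Set
Q v i = Reach v (2 ^ i) (α i)

chain-T : ∀ {n} (A : Term n → Form n) (v : Valuation n) c
        → All (v ⊨_) (map (substF A) (map (λ s → P s ⊃' P (f s)) (T c)))
        → Q v (suc c)
chain-T A v c steps = reach-chain (2 ^ suc c) (λ j j< → reach-elim (All.lookup steps′ (∈-upTo⁺ j<)))
  where steps′ = map⁻ (map⁻ (map⁻ steps))

-- F_i (which contains no X, so any substitution leaves it unchanged)
-- lifts the invariant from i to i+1.
F-step : ∀ {n} (A : Term n → Form n) {v : Valuation n} i
       → v ⊨ substF A (F i) → Q v i → Q v (suc i)
F-step A {v} i Fi qi = reach-double i second first
  where
  t = α (suc i)
  d = 2 ^ i
  both : (not (v t) ∨ v (f^ d t)) ∧ ((not (v (f^ d t)) ∨ v (f^ d (f^ d t))) ∧ true) ≡ true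
  both = ⊃-elim Fi (reach-intro qi)
  first : Reach v d t
  first = reach-elim (∧-elimˡ both)
  second : Reach v d (f^ d t)
  second = reach-elim (∧-elimˡ (∧-elimʳ (not (v t) ∨ v (f^ d t)) both))

ladder : (R : ℕ → Set) (n k : ℕ) → k ≤ n
       → (∀ j → j < k → R (n ∸ j) → R (suc (n ∸ j)))
       → R (suc (n ∸ k)) → R (suc n)
ladder R n zero    _   steps r = r
ladder R n (suc k) k<n steps r =
  ladder R n k (<⇒≤ k<n) (λ j j<k → steps j (<-trans j<k (n<1+n k)))
         (steps k (n<1+n k) (subst R (suc[m∸1+n]≡m∸n k<n) r))

All-map-++'⁻ : ∀ {A B : Set} {Pr : B → Set} (g : A → B) xs ys
             → All Pr (map g (xs ++' ys)) → All Pr (map g xs) × All Pr (map g ys)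
All-map-++'⁻ g []       ys hs       = [] , hs
All-map-++'⁻ g (x ∷ xs) ys (h ∷ hs) with All-map-++'⁻ g xs ys hs
... | l , r = h ∷ l , r

lemma13 : (n k : ℕ) → k < n → IsSolution (seqS n k) (solution n k)
lemma13 n k k<n v (first ∷ rest) with All-map-++'⁻ (substF (solution n k)) (Fs k) _ rest
... | Fs-hold , (Pa ∷ T-hold) =
  run (subst (Reach v (2 ^ suc n)) α-last (ladder (Q v) n k (<⇒≤ k<n) F-holds Q[m+1])) Pa
  where
  A = solution n k
  m = n ∸ k
  Q[m] : Q v m
  Q[m] = subst (Q v) (suc[m∸1+n]≡m∸n (m<n⇒0<n∸m k<n)) (chain-T A v (m ∸ 1) T-hold)
  -- The substituted first antecedent is, definitionally, F_m.
  Q[m+1] : Q v (suc m)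
  Q[m+1] = F-step A m first Q[m]
  F-holds : ∀ j → j < k → Q v (n ∸ j) → Q v (suc (n ∸ j))
  F-holds j j<k = F-step A (n ∸ j) (All.lookup (map⁻ (map⁻ Fs-hold)) (∈-upTo⁺ j<k))
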